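{- Every digraph $D$ is $k$-mixing for every integer $k\ge \delta^*_{\min}(D)+2$.
   Context: A $k$-dicolouring of a digraph $D$ is a map $\alpha:V(D)\to\{1,\dots,k\}$ such that no directed cycle is monochromatic. The $k$-dicolouring graph ${\cal D}_k(D)$ has as vertices the $k$-dicolourings of $D$, two being adjacent if they differ on exactly one vertex; $D$ is $k$-mixing if ${\cal D}_k(D)$ is connected. The min-degeneracy is $\delta^*_{\min}(D)=\max\{\min\{\delta^+(H),\delta^-(H)\} : H \text{ subdigraph of } D\}$, where $\delta^+,\delta^-$ denote minimum out- and in-degree. -}

module Defs where

open import Data.Nat using (ℕ; zero; suc; _+_; _≤_; _⊓_)
open import Data.Fin using (Fin; zero; suc; toℕ)
open import Data.Bool using (Bool; true; false; T)
open import Data.List using (List; allFin; filterᵇ; map; foldr; length)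
open import Data.Product using (Σ; _×_; ∃; ∃-syntax; _,_)
open import Relation.Nullary using (¬_)
open import Relation.Binary.PropositionalEquality using (_≡_; _≢_)
open import Function.Definitions using (Injective)

-- A (finite, simple) digraph on vertex set Fin n: an arc relation with no loops.
-- Digons (u→v and v→u) are allowed; parallel arcs are not.
record Digraph (n : ℕ) : Set where
  field
    arc      : Fin n → Fin n → Bool
    loopless : ∀ v → arc v v ≡ false
open Digraph public

-- successor modulo the cycle length
next : ∀ {m} → Fin (suc m) → Fin (suc m)
next {zero}  zero    = zero
next {suc m} zero    = suc zero
next {suc m} (suc i) with next {m} i
... | zero  = zero
... | suc j = suc (suc j)

-- A directed cycle of length l = m+2 ≥ 2: distinct vertices c 0,...,c (l-1)
-- with arcs c i → c (i+1 mod l).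
record DiCycle {n : ℕ} (D : Digraph n) : Set where
  field
    len-2 : ℕ
    vert  : Fin (suc (suc len-2)) → Fin n
    inj   : Injective _≡_ _≡_ vert
    arcs  : ∀ i → T (arc D (vert i) (vert (next i)))
open DiCycle public

IsDicolouring : ∀ {n} (D : Digraph n) (k : ℕ) → (Fin n → Fin k) → Set
IsDicolouring D k α =
  (C : DiCycle D) → ¬ (∀ i j → α (vert C i) ≡ α (vert C j))

DifferOnExactlyOne : ∀ {n k} → (Fin n → Fin k) → (Fin n → Fin k) → Set
DifferOnExactlyOne {n} α β =
  ∃[ v ] (α v ≢ β v × (∀ u → u ≢ v → α u ≡ β u))

-- walks in the k-dicolouring graph D_k(D), all of whose vertices are dicolourings
data Reachable {n : ℕ} (D : Digraph n) (k : ℕ) :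
       (Fin n → Fin k) → (Fin n → Fin k) → Set where
  here : ∀ {α} → Reachable D k α α
  step : ∀ {α γ β} → DifferOnExactlyOne α γ → IsDicolouring D k γ →
         Reachable D k γ β → Reachable D k α β

Mixing : ∀ {n} (D : Digraph n) (k : ℕ) → Set
Mixing {n} D k =
  (α β : Fin n → Fin k) → IsDicolouring D k α → IsDicolouring D k β →
  Reachable D k α β

record Subdigraph {n : ℕ} (D : Digraph n) : Set where
  field
    inV  : Fin n → Bool
    inA  : Fin n → Fin n → Bool
    sub  : ∀ u v → T (inA u v) → T (inV u) × T (inV v) × T (arc D u v)
open Subdigraph public

NonEmpty : ∀ {n} {D : Digraph n} → Subdigraph D → Set
NonEmpty H = ∃[ v ] T (inV H v)

outdeg indeg : ∀ {n} {D : Digraph n} → Subdigraph D → Fin n → ℕ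
outdeg {n} H v = length (filterᵇ (λ u → inA H v u) (allFin n))
indeg  {n} H v = length (filterᵇ (λ u → inA H u v) (allFin n))

-- minimum of a degree function over the vertices of H.  Degrees are < n, so
-- the initial value n never wins when H is nonempty.
minOver : ∀ {n} {D : Digraph n} → Subdigraph D → (Fin n → ℕ) → ℕ
minOver {n} H f = foldr _⊓_ n (map f (filterᵇ (inV H) (allFin n)))

δ⁺ δ⁻ : ∀ {n} {D : Digraph n} → Subdigraph D → ℕ
δ⁺ H = minOver H (outdeg H)
δ⁻ H = minOver H (indeg H)

IsMinDegeneracy : ∀ {n} → Digraph n → ℕ → Set
IsMinDegeneracy D d =
  (Σ (Subdigraph D) λ H → NonEmpty H × (δ⁺ H ⊓ δ⁻ H ≡ d)) ×
  ((H : Subdigraph D) → NonEmpty H → δ⁺ H ⊓ δ⁻ H ≤ d)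

-- Induction on the vertex set.  A digraph of min-degeneracy at most d has a
-- vertex v whose out-neighbours, or whose in-neighbours, lie among at most d
-- vertices L; giving v a colour that avoids the colours of L cannot create a
-- monochromatic cycle.  So a recolouring sequence of D - v lifts to D: before
-- each step recolouring some u, recolour v with a colour avoiding L and the new
-- colour of u, which exists since k ≥ d + 2.
module Submission where

open import Defs
open import Data.Nat using (ℕ; zero; suc; _+_; _≤_; _<_; _⊓_; s≤s)
open import Data.Nat.Properties using (⊓-sel; +-comm; ≤-trans)
open import Data.Nat.Induction using (<-wellFounded)
open import Data.Fin using (Fin; zero; suc; fromℕ; inject₁)
open import Data.Fin.Properties using (_≟_; any?; ¬∀⟶∃¬; pigeonhole; <-irrefl)
open import Data.Bool using (Bool; T; T?; _∧_)
open import Data.Bool.Properties using (T-∧)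
open import Data.List using (List; []; _∷_; allFin; filter; filterᵇ; map; foldr; length; lookup)
open import Data.List.Properties using (filter-notAll; length-map; length-tabulate)
open import Data.List.Relation.Unary.Any using (here; there; index)
import Data.List.Relation.Unary.Any as Any
open import Data.List.Relation.Unary.Any.Properties using (lookup-index)
open import Data.List.Membership.Propositional using (_∈_; _∉_)
open import Data.List.Membership.Propositional.Properties
  using (∈-allFin; ∈-map⁺; ∈-map⁻; ∈-filter⁺; ∈-filter⁻; foldr-selective)
open import Data.List.Relation.Binary.Subset.Propositional using (_⊆_)
open import Data.List.Relation.Binary.Subset.Propositional.Properties using (filter-⊆)
open import Data.Vec.Functional using (updateAt)
open import Data.Vec.Functional.Properties using (updateAt-updates; updateAt-minimal)
open import Data.Product using (_×_; ∃-syntax; _,_; proj₂)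
open import Data.Sum using (_⊎_; inj₁; inj₂)
open import Function using (_∘_; const; id)
open import Function.Bundles using (Equivalence)
open import Induction.WellFounded using (Acc; acc)
open import Relation.Nullary using (¬_; yes; no; ¬?; contradiction)
open import Relation.Nullary.Decidable using (isYes; toWitness; fromWitness)
open import Relation.Binary.PropositionalEquality

prev : ∀ {m} → Fin (suc m) → Fin (suc m)
prev {m}     zero    = fromℕ m
prev {suc m} (suc i) = inject₁ i

next-fromℕ : ∀ m → next (fromℕ m) ≡ zero
next-fromℕ zero = refl
next-fromℕ (suc m) with next (fromℕ m) | next-fromℕ m
... | .zero | refl = refl

next-inject₁ : ∀ {m} (i : Fin (suc m)) → next (inject₁ i) ≡ suc i
next-inject₁ zero = refl
next-inject₁ {suc m} (suc i) with next (inject₁ i) | next-inject₁ i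
... | .(suc i) | refl = refl

next-prev : ∀ {m} (i : Fin (suc m)) → next (prev i) ≡ i
next-prev {m}     zero    = next-fromℕ m
next-prev {suc m} (suc i) = next-inject₁ i

fresh : ∀ {k} (cs : List (Fin k)) → length cs < k → ∃[ c ] c ∉ cs
fresh {k} cs short = ¬∀⟶∃¬ k (_∈ cs) (λ c → Any.any? (c ≟_) cs) covers-not
  where
  covers-not : ¬ (∀ c → c ∈ cs)
  covers-not covers with pigeonhole short (index ∘ covers)
  ... | i , j , i<j , same = <-irrefl
    (trans (lookup-index (covers i))
      (trans (cong (lookup cs) same) (sym (lookup-index (covers j))))) i<j

foldr-⊓-≤ : ∀ {A : Set} {d} (f : A → ℕ) e xs → foldr _⊓_ e (map f xs) ≤ d →
            e ≤ d ⊎ ∃[ x ] x ∈ xs × f x ≤ d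
foldr-⊓-≤ {d = d} f e xs le with foldr-selective ⊓-sel e (map f xs)
... | inj₁ eq = inj₁ (subst (_≤ d) eq le)
... | inj₂ m with ∈-map⁻ f m
...   | x , x∈xs , eq = inj₂ (x , x∈xs , subst (_≤ d) eq le)

_∖_ : ∀ {n} → List (Fin n) → Fin n → List (Fin n)
Vs ∖ v = filter (λ w → ¬? (w ≟ v)) Vs

∈-∖⁺ : ∀ {n} {Vs : List (Fin n)} {v w} → w ∈ Vs → w ≢ v → w ∈ Vs ∖ v
∈-∖⁺ {v = v} = ∈-filter⁺ (λ w → ¬? (w ≟ v))

∈-∖⁻ : ∀ {n} {Vs : List (Fin n)} {v w} → w ∈ Vs ∖ v → w ≢ v
∈-∖⁻ {Vs = Vs} {v} = proj₂ ∘ ∈-filter⁻ (λ w → ¬? (w ≟ v)) {xs = Vs}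

∖-⊆ : ∀ {n} (Vs : List (Fin n)) v → Vs ∖ v ⊆ Vs
∖-⊆ Vs v = filter-⊆ (λ w → ¬? (w ≟ v)) Vs

length-∖ : ∀ {n} {Vs : List (Fin n)} {v} → v ∈ Vs → length (Vs ∖ v) < length Vs
length-∖ {Vs = Vs} {v} v∈Vs =
  filter-notAll (λ w → ¬? (w ≟ v)) Vs (Any.map (λ v≡w w≢v → w≢v (sym v≡w)) v∈Vs)

T-∧³ : ∀ {a b c} → T a → T b → T c → T (a ∧ b ∧ c)
T-∧³ {a} {b} ta tb tc = Equivalence.from (T-∧ {a}) (ta , Equivalence.from (T-∧ {b}) (tb , tc))

Colouring : ℕ → ℕ → Set
Colouring n k = Fin n → Fin k

_[_]≔_ : ∀ {n k} → Colouring n k → Fin n → Fin k → Colouring n k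
γ [ v ]≔ c = updateAt γ v (const c)

AgreeOff : ∀ {n k} → Fin n → Colouring n k → Colouring n k → Set
AgreeOff v α β = ∀ w → w ≢ v → α w ≡ β w

agreeOff-≔ : ∀ {n k} (γ : Colouring n k) v c → AgreeOff v (γ [ v ]≔ c) γ
agreeOff-≔ γ v c w w≢v = updateAt-minimal w v γ w≢v

agreeOff-trans : ∀ {n k v} {α β γ : Colouring n k} →
                 AgreeOff v α β → AgreeOff v β γ → AgreeOff v α γ
agreeOff-trans αβ βγ w w≢v = trans (αβ w w≢v) (βγ w w≢v)

≔-agreeOff : ∀ {n k u v c} {α β γ : Colouring n k} →
             AgreeOff v α β → AgreeOff u β γ → AgreeOff u (α [ v ]≔ c) (γ [ v ]≔ c)
≔-agreeOff {u = u} {v} {c} {α} {β} {γ} αβ βγ w w≢u with w ≟ v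
... | yes refl = trans (updateAt-updates w α) (sym (updateAt-updates w γ))
... | no  w≢v  = begin
  (α [ v ]≔ c) w  ≡⟨ agreeOff-≔ α v c w w≢v ⟩
  α w             ≡⟨ αβ w w≢v ⟩
  β w             ≡⟨ βγ w w≢u ⟩
  γ w             ≡⟨ agreeOff-≔ γ v c w w≢v ⟨
  (γ [ v ]≔ c) w  ∎
  where open ≡-Reasoning

agreeOff-≗ : ∀ {n k v} {α β : Colouring n k} → AgreeOff v α β → α v ≡ β v → α ≗ β
agreeOff-≗ {v = v} off at w with w ≟ v
... | yes refl = at
... | no w≢v   = off w w≢v

agree-outside-∖ : ∀ {n k} {Vs v} {α β : Colouring n k} → (∀ w → w ∉ Vs → α w ≡ β w) →
                  ∀ w → w ∉ Vs ∖ v → α w ≡ (β [ v ]≔ α v) w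
agree-outside-∖ {v = v} {α} {β} out w w∉ with w ≟ v
... | yes refl = sym (updateAt-updates w β)
... | no  w≢v  = trans (out w (w∉ ∘ λ w∈ → ∈-∖⁺ w∈ w≢v)) (sym (agreeOff-≔ β v (α v) w w≢v))

module Dicolourings {n} (D : Digraph n) (k : ℕ) where

  data Direction : Set where
    forward backward : Direction

  Arc : Direction → Fin n → Fin n → Set
  Arc forward  v w = T (arc D v w)
  Arc backward v w = T (arc D w v)

  Arc-irreflexive : ∀ o {v w} → Arc o v w → w ≢ v
  Arc-irreflexive forward  {v} a refl = subst T (loopless D v) a
  Arc-irreflexive backward {v} a refl = subst T (loopless D v) a

  cycle-neighbour : (C : DiCycle D) (o : Direction) (i : Fin (suc (suc (len-2 C)))) →
                    ∃[ j ] Arc o (vert C i) (vert C j)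
  cycle-neighbour C forward  i = next i , arcs C i
  cycle-neighbour C backward i =
    prev i , subst (λ j → T (arc D (vert C (prev i)) (vert C j))) (next-prev i) (arcs C (prev i))

  Monochromatic : Colouring n k → DiCycle D → Set
  Monochromatic γ C = ∀ i j → γ (vert C i) ≡ γ (vert C j)

  DicolouringOn : List (Fin n) → Colouring n k → Set
  DicolouringOn Vs γ = (C : DiCycle D) → (∀ i → vert C i ∈ Vs) → ¬ Monochromatic γ C

  dicolouringOn-⊆ : ∀ {Ws Vs γ} → Ws ⊆ Vs → DicolouringOn Vs γ → DicolouringOn Ws γ
  dicolouringOn-⊆ Ws⊆Vs dγ C inWs = dγ C (Ws⊆Vs ∘ inWs)

  dicolouringOn-cong : ∀ {Vs γ η} → (∀ {w} → w ∈ Vs → γ w ≡ η w) →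
                       DicolouringOn Vs γ → DicolouringOn Vs η
  dicolouringOn-cong γ≈η dγ C inVs mono =
    dγ C inVs (λ i j → trans (γ≈η (inVs i)) (trans (mono i j) (sym (γ≈η (inVs j)))))

  dicolouringOn-∖-≔ : ∀ {Vs v γ c} → DicolouringOn Vs γ → DicolouringOn (Vs ∖ v) (γ [ v ]≔ c)
  dicolouringOn-∖-≔ {Vs} {v} {γ} {c} dγ =
    dicolouringOn-cong {γ = γ} (λ w∈ → sym (agreeOff-≔ γ v c _ (∈-∖⁻ {Vs = Vs} w∈)))
      (dicolouringOn-⊆ {γ = γ} (∖-⊆ Vs v) dγ)

  -- A monochromatic cycle through v leaves v along an out-arc and enters it
  -- along an in-arc, so it suffices that v's colour avoids one of the two sides.
  recolour-dicolouring : ∀ {Vs v γ c} o → DicolouringOn (Vs ∖ v) γ →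
                         (∀ {w} → w ∈ Vs → Arc o v w → γ w ≢ c) →
                         DicolouringOn Vs (γ [ v ]≔ c)
  recolour-dicolouring {v = v} {γ} {c} o dγ avoid C inVs mono
    with any? (λ i → vert C i ≟ v)
  ... | yes (i , refl) with cycle-neighbour C o i
  ...   | j , a = avoid (inVs j) a (begin
          γ (vert C j)                 ≡⟨ agreeOff-≔ γ v c _ (Arc-irreflexive o a) ⟨
          (γ [ v ]≔ c) (vert C j)      ≡⟨ mono j i ⟩
          (γ [ v ]≔ c) (vert C i)      ≡⟨ updateAt-updates v γ ⟩
          c                            ∎)
    where open ≡-Reasoning
  recolour-dicolouring {v = v} {γ} {c} o dγ avoid C inVs mono | no v∉C =
    dγ C (λ i → ∈-∖⁺ (inVs i) (v∉C ∘ (i ,_)))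
      (λ i j → trans (sym (agreeOff-≔ γ v c _ (v∉C ∘ (i ,_))))
                 (trans (mono i j) (agreeOff-≔ γ v c _ (v∉C ∘ (j ,_)))))

  Sparse : ℕ → List (Fin n) → Fin n → Set
  Sparse d Vs v = ∃[ o ] ∃[ L ] length L ≤ d × (∀ {w} → w ∈ Vs → Arc o v w → w ∈ L)

  open import Data.List.Membership.DecPropositional (_≟_ {n}) using (_∈?_)

  induced : List (Fin n) → Subdigraph D
  induced Vs = record
    { inV = inVs
    ; inA = λ u w → inVs u ∧ inVs w ∧ arc D u w
    ; sub = λ u w uw → let u∈ , rest = Equivalence.to (T-∧ {inVs u}) uw
                       in u∈ , Equivalence.to (T-∧ {inVs w}) rest
    }
    where
    inVs : Fin n → Bool
    inVs w = isYes (w ∈? Vs)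

  neighbours : Direction → List (Fin n) → Fin n → List (Fin n)
  neighbours forward  Vs v = filterᵇ (λ u → inA (induced Vs) v u) (allFin n)
  neighbours backward Vs v = filterᵇ (λ u → inA (induced Vs) u v) (allFin n)

  ∈-neighbours : ∀ o {Vs v w} → v ∈ Vs → w ∈ Vs → Arc o v w → w ∈ neighbours o Vs v
  ∈-neighbours forward {Vs} {v} {w} v∈ w∈ a =
    ∈-filter⁺ (T? ∘ inA (induced Vs) v) (∈-allFin w)
      (T-∧³ {isYes (v ∈? Vs)} {isYes (w ∈? Vs)} (fromWitness v∈) (fromWitness w∈) a)
  ∈-neighbours backward {Vs} {v} {w} v∈ w∈ a =
    ∈-filter⁺ (λ u → T? (inA (induced Vs) u v)) (∈-allFin w)
      (T-∧³ {isYes (w ∈? Vs)} {isYes (v ∈? Vs)} (fromWitness w∈) (fromWitness v∈) a)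

  sparse-of-minDegree : ∀ {d} o {Vs w} → w ∈ Vs →
                        minOver (induced Vs) (length ∘ neighbours o Vs) ≤ d →
                        ∃[ v ] v ∈ Vs × Sparse d Vs v
  sparse-of-minDegree {d} o {Vs} {w} w∈ le
    with foldr-⊓-≤ (length ∘ neighbours o Vs) n (filterᵇ (inV (induced Vs)) (allFin n)) le
  -- the minimum is the initial value n: every vertex is sparse, with L all vertices
  ... | inj₁ n≤d =
    w , w∈ , forward , allFin n , subst (_≤ d) (sym (length-tabulate id)) n≤d ,
    λ {u} _ _ → ∈-allFin u
  ... | inj₂ (v , v∈filter , le′) =
    v , v∈ , o , neighbours o Vs v , le′ , ∈-neighbours o v∈
    where
    v∈ : v ∈ Vs
    v∈ = toWitness (proj₂ (∈-filter⁻ (T? ∘ inV (induced Vs)) {xs = allFin n} v∈filter))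

  sparse-vertex : ∀ {d} → ((H : Subdigraph D) → NonEmpty H → δ⁺ H ⊓ δ⁻ H ≤ d) →
                  ∀ {Vs w} → w ∈ Vs → ∃[ v ] v ∈ Vs × Sparse d Vs v
  sparse-vertex {d} hmin {Vs} {w} w∈
    with bound ← hmin (induced Vs) (w , fromWitness w∈)
       | ⊓-sel (δ⁺ (induced Vs)) (δ⁻ (induced Vs))
  ... | inj₁ eq = sparse-of-minDegree forward  w∈ (subst (_≤ d) eq bound)
  ... | inj₂ eq = sparse-of-minDegree backward w∈ (subst (_≤ d) eq bound)

  -- Unlike Reachable, steps may change nothing and endpoints agree only
  -- pointwise: this is what the induction on Vs naturally produces.
  data Walk (Vs : List (Fin n)) : Colouring n k → Colouring n k → Set where
    stop     : ∀ {α β} → α ≗ β → Walk Vs α β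
    recolour : ∀ {α γ β} u → AgreeOff u α γ → DicolouringOn Vs γ →
               Walk Vs γ β → Walk Vs α β

  walk-snoc : ∀ {Vs α γ β} v → Walk Vs α γ → AgreeOff v γ β → DicolouringOn Vs β →
              Walk Vs α β
  walk-snoc v (stop α≗γ) γβ dβ =
    recolour v (λ w w≢v → trans (α≗γ w) (γβ w w≢v)) dβ (stop (λ _ → refl))
  walk-snoc v (recolour u αγ dγ rest) γβ dβ = recolour u αγ dγ (walk-snoc v rest γβ dβ)

  Recolourable : Colouring n k → Set
  Recolourable β = ∃[ v ] ∃[ c ] c ≢ β v × IsDicolouring D k (β [ v ]≔ c)

  -- Reachable needs its endpoints to be definitionally equal, so two pointwise
  -- equal colourings are joined by recolouring some vertex away and back.
  module _ (recolourable : ∀ {β} → IsDicolouring D k β → Recolourable β) where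

    reachable-≗ : ∀ {α β} → α ≗ β → IsDicolouring D k β → Reachable D k α β
    reachable-≗ {α} {β} α≗β dβ with recolourable dβ
    ... | v , c , c≢βv , dη =
      step (v , αv≢c , off) dη
        (step (v , c≢βv ∘ trans (sym (updateAt-updates v β)) , agreeOff-≔ β v c) dβ here)
      where
      αv≢c : α v ≢ (β [ v ]≔ c) v
      αv≢c αv≡ = c≢βv (trans (sym (trans αv≡ (updateAt-updates v β))) (α≗β v))
      off : AgreeOff v α (β [ v ]≔ c)
      off w w≢v = trans (α≗β w) (sym (agreeOff-≔ β v c w w≢v))

    reachable-resp-≗ : ∀ {α γ β} → α ≗ γ → IsDicolouring D k β →
                       Reachable D k γ β → Reachable D k α β
    reachable-resp-≗ α≗γ dβ here = reachable-≗ α≗γ dβ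
    reachable-resp-≗ α≗γ dβ (step (u , γu≢ , off) dη rest) =
      step (u , γu≢ ∘ trans (sym (α≗γ u)) , (λ w w≢u → trans (α≗γ w) (off w w≢u))) dη rest

    walk⇒reachable : ∀ {α β} → Walk (allFin n) α β → IsDicolouring D k β →
                     Reachable D k α β
    walk⇒reachable (stop α≗β) dβ = reachable-≗ α≗β dβ
    walk⇒reachable {α} (recolour {γ = γ} u off dγ rest) dβ with α u ≟ γ u
    ... | yes same = reachable-resp-≗ (agreeOff-≗ off same) dβ (walk⇒reachable rest dβ)
    ... | no  diff = step (u , diff , off) (λ C → dγ C (∈-allFin ∘ vert C))
                       (walk⇒reachable rest dβ)

  module _ {d} (hk : d + 2 ≤ k) where

    spare-colour : (L : List (Fin n)) → length L ≤ d → (x : Fin k) (γ : Colouring n k) →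
                   ∃[ c ] c ≢ x × (∀ {w} → w ∈ L → γ w ≢ c)
    spare-colour L hL x γ with fresh (x ∷ map γ L) short
      where
      short : suc (length (map γ L)) < k
      short = ≤-trans (s≤s (s≤s (subst (_≤ d) (sym (length-map γ L)) hL)))
                      (subst (_≤ k) (+-comm d 2) hk)
    ... | c , c∉ =
      c , c∉ ∘ here , λ w∈L γw≡c → c∉ (there (subst (_∈ map γ L) γw≡c (∈-map⁺ γ w∈L)))

    sparse-recolourable : ∀ {v β} → Sparse d (allFin n) v → IsDicolouring D k β → Recolourable β
    sparse-recolourable {v} {β} (o , L , hL , cover) dβ with spare-colour L hL (β v) β
    ... | c , c≢βv , avoid =
      v , c , c≢βv , λ C → recolour-dicolouring o (λ C′ _ → dβ C′) (λ w∈ a → avoid (cover w∈ a))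
                             C (∈-allFin ∘ vert C)

    lift-step : ∀ {Vs v u γ* γ γ′} → Sparse d Vs v → DicolouringOn Vs γ* → AgreeOff v γ* γ →
                AgreeOff u γ γ′ → DicolouringOn (Vs ∖ v) γ′ →
                ∃[ c ] DicolouringOn Vs (γ* [ v ]≔ c) × DicolouringOn Vs (γ′ [ v ]≔ c)
    lift-step {Vs} {v} {u} {γ*} {γ} {γ′} (o , L , hL , cover) dγ* γ*γ γγ′ dγ′
      with spare-colour L hL (γ′ u) γ*
    ... | c , c≢γ′u , avoid =
      c , recolour-dicolouring o (dicolouringOn-⊆ {γ = γ*} (∖-⊆ Vs v) dγ*)
                               (λ w∈ a → avoid (cover w∈ a))
        , recolour-dicolouring o dγ′ avoid′
      where
      avoid′ : ∀ {w} → w ∈ Vs → Arc o v w → γ′ w ≢ c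
      avoid′ {w} w∈ a with w ≟ u
      ... | yes refl = c≢γ′u ∘ sym
      ... | no  w≢u  = λ γ′w≡c →
        avoid (cover w∈ a) (trans (γ*γ w (Arc-irreflexive o a)) (trans (γγ′ w w≢u) γ′w≡c))

    lift : ∀ {Vs v γ δ γ*} → Sparse d Vs v → Walk (Vs ∖ v) γ δ → DicolouringOn Vs γ* →
           AgreeOff v γ* γ → ∃[ δ* ] AgreeOff v δ* δ × Walk Vs γ* δ*
    lift sp (stop γ≗δ) dγ* γ*γ = _ , (λ w w≢v → trans (γ*γ w w≢v) (γ≗δ w)) , stop (λ _ → refl)
    lift {v = v} {γ* = γ*} sp (recolour {γ = γ′} u γγ′ dγ′ rest) dγ* γ*γ
      with lift-step sp dγ* γ*γ γγ′ dγ′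
    ... | c , dη , dη′ with lift sp rest dη′ (agreeOff-≔ γ′ v c)
    ...   | δ* , δ*δ , walk =
      δ* , δ*δ , recolour v (λ w w≢v → sym (agreeOff-≔ γ* v c w w≢v)) dη
                   (recolour u (≔-agreeOff γ*γ γγ′) dη′ walk)

    walk-between : ((H : Subdigraph D) → NonEmpty H → δ⁺ H ⊓ δ⁻ H ≤ d) →
                   ∀ {Vs α β} → Acc _<_ (length Vs) → DicolouringOn Vs α → DicolouringOn Vs β →
                   (∀ w → w ∉ Vs → α w ≡ β w) → Walk Vs α β
    walk-between hmin {[]} _ dα dβ out = stop (λ w → out w λ ())
    walk-between hmin {Vs@(_ ∷ _)} {α} {β} (acc rs) dα dβ out with sparse-vertex hmin (here refl)
    ... | v , v∈Vs , sp
      with lift sp (walk-between hmin (rs (length-∖ v∈Vs)) (dicolouringOn-⊆ {γ = α} (∖-⊆ Vs v) dα)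
                     (dicolouringOn-∖-≔ {γ = β} dβ) (agree-outside-∖ out)) dα (λ _ _ → refl)
    ... | δ* , δ*β′ , walk = walk-snoc v walk (agreeOff-trans δ*β′ (agreeOff-≔ β v (α v))) dβ

theorem6 : ∀ {n} (D : Digraph n) (d k : ℕ) → IsMinDegeneracy D d →
    d + 2 ≤ k → Mixing D k
theorem6 D d k ((_ , (v , _) , _) , hmin) hk α β dα dβ =
  walk⇒reachable recolourable
    (walk-between hk hmin (<-wellFounded _) (λ C _ → dα C) (λ C _ → dβ C)
      (λ w w∉ → contradiction (∈-allFin w) w∉))
    dβ
  where
  open Dicolourings D k
  recolourable : ∀ {γ} → IsDicolouring D k γ → Recolourable γ
  recolourable = sparse-recolourable hk (proj₂ (proj₂ (sparse-vertex hmin (∈-allFin v))))
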